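{- For any connected graph $G$ of order $n\ge 2$, $\gamma_{tc}(M(G\circ K_1))=2n$.
   Context: All graphs are finite, simple and undirected. The corona $G\circ K_1$ is the graph of order $2|V(G)|$ obtained from $G$ by attaching a new pendant vertex (by a pendant edge) to each vertex of $G$. For a graph $H$, a set $D\subseteq V(H)$ is a total dominating set if every vertex of $H$ has a neighbor in $D$. A set $D\subseteq V(H)$ is a total outer-connected dominating set of $H$ if $D$ is a total dominating set and the induced subgraph $H[V(H)\setminus D]$ is connected; $\gamma_{tc}(H)$ denotes the minimum cardinality of a total outer-connected dominating set of $H$. The middle graph $M(G)$ of a graph $G$ has vertex set $V(G)\cup E(G)$, where two elements $x,y$ are adjacent iff either $x,y\in E(G)$ are edges of $G$ sharing an endpoint, or one of them is a vertex of $G$ and the other is an edge of $G$ incident to it. -}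

module Defs where

open import Data.Nat using (ℕ; _≤_)
open import Data.Fin using (Fin; _<_)
open import Data.Bool using (Bool; T; false)
open import Data.Sum using (_⊎_; inj₁; inj₂)
open import Data.Product using (_×_; ∃)
open import Data.Unit using (⊤)
open import Data.Empty using (⊥)
open import Data.List using (List; length)
open import Data.List.Membership.Propositional using (_∈_; _∉_)
open import Data.List.Relation.Unary.Unique.Propositional using (Unique)
open import Relation.Binary.PropositionalEquality using (_≡_; _≢_)
open import Relation.Nullary using (¬_)

-- A finite simple graph of order n, on vertex set Fin n,
-- with Boolean (hence proof-irrelevant) adjacency, symmetric and loopless.
record SimpleGraph (n : ℕ) : Set where
  field
    adj    : Fin n → Fin n → Bool
    sym    : ∀ i j → adj i j ≡ adj j i
    irrefl : ∀ i → adj i i ≡ false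
open SimpleGraph public

data Walk {V : Set} (R : V → V → Set) (P : V → Set) : V → V → Set where
  stop : ∀ {v} → Walk R P v v
  step : ∀ {u v w} → R u v → P v → Walk R P v w → Walk R P u w

ConnectedOn : {V : Set} → (V → V → Set) → (V → Set) → Set
ConnectedOn {V} R P = ∀ (u v : V) → P u → P v → Walk R P u v

Connected : ∀ {n} → SimpleGraph n → Set
Connected G = ConnectedOn (λ i j → T (adj G i j)) (λ _ → ⊤)

record IncGraph : Set₁ where
  field
    V    : Set
    E    : Set
    _inc_ : V → E → Set
open IncGraph public

-- Corona G ∘ K₁: vertices inj₁ i (original) and inj₂ i (pendant at i).
data CoronaEdge {n : ℕ} (G : SimpleGraph n) : Set where
  orig : (i j : Fin n) → i < j → T (adj G i j) → CoronaEdge G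
  pend : (i : Fin n) → CoronaEdge G

coronaInc : ∀ {n} {G : SimpleGraph n} → Fin n ⊎ Fin n → CoronaEdge G → Set
coronaInc (inj₁ k) (orig i j _ _) = k ≡ i ⊎ k ≡ j
coronaInc (inj₂ k) (orig i j _ _) = ⊥
coronaInc (inj₁ k) (pend i) = k ≡ i
coronaInc (inj₂ k) (pend i) = k ≡ i

Corona : ∀ {n} → SimpleGraph n → IncGraph
Corona {n} G = record { V = Fin n ⊎ Fin n ; E = CoronaEdge G ; _inc_ = coronaInc }

MV : IncGraph → Set
MV H = V H ⊎ E H

MAdj : (H : IncGraph) → MV H → MV H → Set
MAdj H (inj₁ v) (inj₁ w) = ⊥
MAdj H (inj₁ v) (inj₂ e) = _inc_ H v e
MAdj H (inj₂ e) (inj₁ v) = _inc_ H v e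
MAdj H (inj₂ e) (inj₂ f) = e ≢ f × ∃ λ v → _inc_ H v e × _inc_ H v f

-- Sets of vertices are duplicate-free lists; cardinality = length.
IsTotalDominating : {V : Set} → (V → V → Set) → List V → Set
IsTotalDominating {V} R D = ∀ (v : V) → ∃ λ u → u ∈ D × R v u

IsTOCDS : {V : Set} → (V → V → Set) → List V → Set
IsTOCDS R D = IsTotalDominating R D × ConnectedOn R (λ v → v ∉ D)

γtc≡ : {V : Set} → (V → V → Set) → ℕ → Set
γtc≡ {V} R k =
  (∃ λ (D : List V) → Unique D × IsTOCDS R D × length D ≡ k) ×
  (∀ (D : List V) → Unique D → IsTOCDS R D → k ≤ length D)

-- The pendant vertex u of each vertex v of G is adjacent in M(G ∘ K₁) only to the
-- pendant edge vu, so a total dominating set D contains all n pendant edges. If D also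
-- contains all n pendant vertices we are done; otherwise some pendant vertex u ∉ D is
-- isolated in M(G ∘ K₁) − D, and outer-connectedness forces M(G ∘ K₁) − D = {u}, so D
-- contains all n original vertices as well. Conversely, pendant edges together with
-- pendant vertices form a total dominating set whose complement, the middle graph of G,
-- is connected because G is.
module Submission where

open import Defs hiding (sym)
open import Data.Nat using (ℕ; _≤_; _*_; _+_; _≤?_)
open import Data.Nat.Properties using (≰⇒>; +-identityʳ; <-irrefl)
open import Data.Fin using (Fin; toℕ; splitAt; join)
open import Data.Fin.Properties using (<-cmp; pigeonhole; join-splitAt; splitAt-join; ¬∀⟶∃¬; all?)
  renaming (_≟_ to _≟ᶠ_)
open import Data.Bool using (T)
open import Data.Sum using (_⊎_; inj₁; inj₂; [_,_]; [_,_]′)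
open import Data.Sum.Properties using (≡-dec; inj₁-injective; inj₂-injective)
open import Data.Product using (∃; _×_; _,_)
open import Data.Unit using (tt)
open import Data.Empty using (⊥-elim)
open import Data.List using (List; length; map; lookup; allFin)
open import Data.List.Properties using (length-map; length-tabulate)
open import Data.List.Relation.Unary.Any using (index; any?)
open import Data.List.Relation.Unary.Any.Properties using (lookup-index)
open import Data.List.Membership.Propositional using (_∈_; _∉_)
open import Data.List.Membership.Propositional.Properties using (∈-map⁺; ∈-map⁻; ∈-allFin)
open import Data.List.Relation.Unary.Unique.Propositional using (Unique)
open import Data.List.Relation.Unary.Unique.Propositional.Properties using (map⁺; allFin⁺)
open import Function using (_∘_)
open import Function.Definitions using (Injective)
open import Relation.Binary.PropositionalEquality
  using (_≡_; refl; sym; trans; cong; subst; module ≡-Reasoning)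
open import Relation.Binary.Definitions using (tri<; tri≈; tri>)
open import Relation.Nullary using (¬_; Dec; yes; no; map′)

injective⇒≤length : ∀ {A : Set} {m} (f : Fin m → A) → Injective _≡_ _≡_ f →
                    (xs : List A) → (∀ i → f i ∈ xs) → m ≤ length xs
injective⇒≤length {m = m} f f-inj xs f∈xs with m ≤? length xs
... | yes m≤len = m≤len
... | no m≰len with pigeonhole (≰⇒> m≰len) (index ∘ f∈xs)
...   | i , j , i<j , same-index = ⊥-elim (<-irrefl (cong toℕ (f-inj fi≡fj)) i<j)
  where
    open ≡-Reasoning
    fi≡fj : f i ≡ f j
    fi≡fj = begin
      f i                        ≡⟨ lookup-index (f∈xs i) ⟩
      lookup xs (index (f∈xs i)) ≡⟨ cong (lookup xs) same-index ⟩
      lookup xs (index (f∈xs j)) ≡⟨ sym (lookup-index (f∈xs j)) ⟩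
      f j                        ∎

splitAt-injective : ∀ m {n} → Injective _≡_ _≡_ (splitAt m {n})
splitAt-injective m {n} {i} {j} eq =
  trans (sym (join-splitAt m n i)) (trans (cong (join m n) eq) (join-splitAt m n j))

module _ {V : Set} {R : V → V → Set} {P : V → Set} where

  _◅◅_ : ∀ {u v w} → Walk R P u v → Walk R P v w → Walk R P u w
  stop       ◅◅ q = q
  step r p w ◅◅ q = step r p (w ◅◅ q)

  Walk-isolated : ∀ {u v} → (∀ {w} → R u w → ¬ P w) → Walk R P u v → u ≡ v
  Walk-isolated _        stop         = refl
  Walk-isolated isolated (step r p _) = ⊥-elim (isolated r p)

Walk-concatMap : ∀ {A B : Set} {R : A → A → Set} {P : A → Set}
                 {S : B → B → Set} {Q : B → Set} (f : A → B) →
                 (∀ {a a′} → R a a′ → Walk S Q (f a) (f a′)) →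
                 ∀ {a a′} → Walk R P a a′ → Walk S Q (f a) (f a′)
Walk-concatMap f edge stop         = stop
Walk-concatMap f edge (step r _ w) = edge r ◅◅ Walk-concatMap f edge w

module MiddleCorona {n : ℕ} (G : SimpleGraph n) where

  M : Set
  M = MV (Corona G)

  _~_ : M → M → Set
  _~_ = MAdj (Corona G)

  vertex leaf pendantEdge : Fin n → M
  vertex i      = inj₁ (inj₁ i)
  leaf i        = inj₁ (inj₂ i)
  pendantEdge i = inj₂ (pend i)

  leaf-neighbour : ∀ {i x} → leaf i ~ x → x ≡ pendantEdge i
  leaf-neighbour {x = inj₂ (pend _)} refl = refl

  -- An injective g picks n distinct corona vertices; the image of pendantEdgeOr g is
  -- the n pendant edges together with them.
  pendantEdgeOr : (Fin n → Fin n ⊎ Fin n) → Fin n ⊎ Fin n → M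
  pendantEdgeOr g = [ pendantEdge , inj₁ ∘ g ]′

  pendantEdgeOr-injective : ∀ {g} → Injective _≡_ _≡_ g → Injective _≡_ _≡_ (pendantEdgeOr g)
  pendantEdgeOr-injective g-inj {inj₁ _} {inj₁ _} refl = refl
  pendantEdgeOr-injective g-inj {inj₂ _} {inj₂ _} eq   = cong inj₂ (g-inj (inj₁-injective eq))

  2n≡n+n : 2 * n ≡ n + n
  2n≡n+n = cong (n +_) (+-identityʳ n)

  ≤length-of-pendantEdgeOr : ∀ {g} → Injective _≡_ _≡_ g → (D : List M) →
                             (∀ j → pendantEdge j ∈ D) → (∀ j → inj₁ (g j) ∈ D) →
                             2 * n ≤ length D
  ≤length-of-pendantEdgeOr {g} g-inj D edges∈D chosen∈D =
    subst (_≤ length D) (sym 2n≡n+n)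
      (injective⇒≤length (pendantEdgeOr g ∘ splitAt n)
        (splitAt-injective n ∘ pendantEdgeOr-injective g-inj) D
        ([_,_] {C = λ y → pendantEdgeOr g y ∈ D} edges∈D chosen∈D ∘ splitAt n))

  module UpperBound where

    D₀ : List M
    D₀ = map (pendantEdgeOr inj₂ ∘ splitAt n) (allFin (n + n))

    D₀-unique : Unique D₀
    D₀-unique = map⁺ (splitAt-injective n ∘ pendantEdgeOr-injective inj₂-injective) (allFin⁺ (n + n))

    D₀-length : length D₀ ≡ 2 * n
    D₀-length = trans (length-map _ (allFin (n + n)))
                      (trans (length-tabulate {n = n + n} (λ i → i)) (sym 2n≡n+n))

    pendantEdgeOr∈D₀ : ∀ y → pendantEdgeOr inj₂ y ∈ D₀
    pendantEdgeOr∈D₀ y = subst (_∈ D₀) (cong (pendantEdgeOr inj₂) (splitAt-join n n y))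
                                        (∈-map⁺ (pendantEdgeOr inj₂ ∘ splitAt n) (∈-allFin (join n n y)))

    ∈D₀⇒ : ∀ {x} → x ∈ D₀ → ∃ λ y → x ≡ pendantEdgeOr inj₂ y
    ∈D₀⇒ x∈ with ∈-map⁻ _ x∈
    ... | i , _ , eq = splitAt n i , eq

    vertex∉D₀ : ∀ i → vertex i ∉ D₀
    vertex∉D₀ i x∈ with ∈D₀⇒ x∈
    ... | inj₁ _ , ()
    ... | inj₂ _ , ()

    edge∉D₀ : ∀ {i j} i<j a → inj₂ (orig i j i<j a) ∉ D₀
    edge∉D₀ _ _ x∈ with ∈D₀⇒ x∈
    ... | inj₁ _ , ()
    ... | inj₂ _ , ()

    D₀-totalDominating : IsTotalDominating _~_ D₀
    D₀-totalDominating (inj₁ (inj₁ i))       = pendantEdge i , pendantEdgeOr∈D₀ (inj₁ i) , refl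
    D₀-totalDominating (inj₁ (inj₂ i))       = pendantEdge i , pendantEdgeOr∈D₀ (inj₁ i) , refl
    D₀-totalDominating (inj₂ (orig i j _ _)) =
      pendantEdge i , pendantEdgeOr∈D₀ (inj₁ i) , (λ ()) , inj₁ i , inj₁ refl , refl
    D₀-totalDominating (inj₂ (pend i))       = leaf i , pendantEdgeOr∈D₀ (inj₂ i) , refl

    OuterWalk : M → M → Set
    OuterWalk = Walk _~_ (_∉ D₀)

    vertex-step : ∀ {i k} → T (adj G i k) → OuterWalk (vertex i) (vertex k)
    vertex-step {i} {k} a with <-cmp i k
    ... | tri< i<k _ _ = step (inj₁ refl) (edge∉D₀ i<k a) (step (inj₂ refl) (vertex∉D₀ k) stop)
    ... | tri≈ _ refl _ = ⊥-elim (subst T (irrefl G i) a)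
    ... | tri> _ _ k<i =
      step (inj₂ refl) (edge∉D₀ k<i (subst T (SimpleGraph.sym G i k) a))
        (step (inj₁ refl) (vertex∉D₀ k) stop)

    anchored : ∀ x → x ∉ D₀ → ∃ λ i → OuterWalk x (vertex i) × OuterWalk (vertex i) x
    anchored (inj₁ (inj₁ i))       _  = i , stop , stop
    anchored (inj₁ (inj₂ i))       x∉ = ⊥-elim (x∉ (pendantEdgeOr∈D₀ (inj₂ i)))
    anchored (inj₂ (orig i _ _ _)) x∉ =
      i , step (inj₁ refl) (vertex∉D₀ i) stop , step (inj₁ refl) x∉ stop
    anchored (inj₂ (pend i))       x∉ = ⊥-elim (x∉ (pendantEdgeOr∈D₀ (inj₁ i)))

    D₀-outerConnected : Connected G → ConnectedOn _~_ (_∉ D₀)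
    D₀-outerConnected G-connected x y x∉ y∉
      with i , x→i , _ ← anchored x x∉
         | j , _ , j→y ← anchored y y∉ =
      x→i ◅◅ (Walk-concatMap vertex vertex-step (G-connected i j tt tt) ◅◅ j→y)

  module LowerBound (D : List M) (dominating : IsTotalDominating _~_ D)
                    (outer-connected : ConnectedOn _~_ (_∉ D)) where

    pendantEdge∈D : ∀ j → pendantEdge j ∈ D
    pendantEdge∈D j with u , u∈D , leaf~u ← dominating (leaf j) =
      subst (_∈ D) (leaf-neighbour leaf~u) u∈D

    leaf-isolated : ∀ i {x} → leaf i ~ x → ¬ x ∉ D
    leaf-isolated i leaf~x x∉D = x∉D (subst (_∈ D) (sym (leaf-neighbour leaf~x)) (pendantEdge∈D i))

    -- Decided only for corona vertices: deciding equality of corona edges would need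
    -- irrelevance of the witnesses stored in orig.
    _∈D? : (a : Fin n ⊎ Fin n) → Dec (inj₁ a ∈ D)
    a ∈D? = any? (inj₁-≟ a) D
      where
        inj₁-≟ : (a : Fin n ⊎ Fin n) (x : M) → Dec (inj₁ a ≡ x)
        inj₁-≟ a (inj₁ b) = map′ (cong inj₁) inj₁-injective (≡-dec _≟ᶠ_ _≟ᶠ_ a b)
        inj₁-≟ a (inj₂ _) = no (λ ())

    vertex∈D : ∀ {i} → leaf i ∉ D → ∀ j → vertex j ∈ D
    vertex∈D {i} leaf∉D j with inj₁ j ∈D?
    ... | yes vertex∈D = vertex∈D
    ... | no vertex∉D
      with () ← Walk-isolated (leaf-isolated i) (outer-connected (leaf i) (vertex j) leaf∉D vertex∉D)

    2n≤length : 2 * n ≤ length D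
    2n≤length with all? (λ i → inj₂ i ∈D?)
    ... | yes leaf∈D = ≤length-of-pendantEdgeOr inj₂-injective D pendantEdge∈D leaf∈D
    ... | no ¬leaf∈D with _ , leaf∉D ← ¬∀⟶∃¬ n _ (λ i → inj₂ i ∈D?) ¬leaf∈D =
      ≤length-of-pendantEdgeOr inj₁-injective D pendantEdge∈D (vertex∈D leaf∉D)

-- Neither 2 ≤ n nor the uniqueness of the entries of D is needed.
theorem4p1 : (n : ℕ) → 2 ≤ n → (G : SimpleGraph n) → Connected G →
    γtc≡ (MAdj (Corona G)) (2 * n)
theorem4p1 n _ G G-connected =
  (D₀ , D₀-unique , (D₀-totalDominating , D₀-outerConnected G-connected) , D₀-length) ,
  λ D _ (dominating , outer-connected) → LowerBound.2n≤length D dominating outer-connected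
  where open MiddleCorona G
        open UpperBound
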